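{- Let $\mathcal{G}$ be a concurrent game structure and $Z=(\chi,\mathrm{I},\rho)$ a state whose information perspective $\mathrm{I}$ is truthful. Then for every agent $a$ and every formula $\phi$ of $\mathcal{L}^{\mathsf C}$, $\mathcal{G},Z\Vdash\lnot\mathsf{K}_a\bot\to(\mathsf{K}_a\phi\to\phi)$.
   Context: Fix a countable set $\mathsf{Prop}$ of atomic propositions and a finite set $\mathsf{Ag}$ of agents. A concurrent game structure is a tuple $\mathcal{G}=(\mathsf{Ac},\mathsf{V},\mathsf{E},\ell,(\sim_a)_{a\in\mathsf{Ag}})$ where $\mathsf{Ac}$ is a finite set of actions, $\mathsf{V}$ is a finite set of positions, $\mathsf{E}:\mathsf{V}\times\mathsf{Ac}^{\mathsf{Ag}}\to\mathsf{V}$ is a transition function, $\ell:\mathsf{V}\to\mathcal{P}(\mathsf{Prop})$ is a valuation, and for each agent $a$, $\sim_a\subseteq(\mathsf{V}\times\mathsf{V})\cup(\mathsf{Ac}\times\mathsf{Ac})$ is an equivalence relation. A joint action is a function $\alpha:\mathsf{Ag}\to\mathsf{Ac}$; $\alpha\sim_a\beta$ iff $\alpha(b)\sim_a\beta(b)$ for all $b$. A history is a sequence $\rho=v_0\alpha_1v_1\ldots\alpha_nv_n$ of positions and joint actions with $\mathsf{E}(v_i,\alpha_{i+1})=v_{i+1}$ for all $i<n$; $\rho_{\le i}=v_0\alpha_1\ldots\alpha_iv_i$, $\mathsf{last}(\rho)=v_n$; $\mathsf{Hist}$ is the set of histories. $\rho\sim_a\rho'$ for histories iff they have the same number $n$ of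 joint actions, their $i$-th positions are $\sim_a$-related for all $i\le n$ and their $i$-th joint actions are $\sim_a$-related for all $1\le i\le n$. A strategy is a function $\mathsf{Hist}\to\mathsf{Ac}$; an assignment is a function $\chi$ from $\mathsf{Ag}$ to strategies. $\rho$ is consistent with $\chi$ for $X\subseteq\mathsf{Ag}$ if $\alpha_{i+1}(b)=\chi(b)(\rho_{\le i})$ for all $i<n$, $b\in X$. The one-step continuation is $\mathsf{X}^\chi_{\mathcal G}\rho=v_0\alpha_1\ldots\alpha_nv_n\alpha_{n+1}v_{n+1}$ with $\alpha_{n+1}(b)=\chi(b)(\rho)$ for all $b$ and $v_{n+1}=\mathsf{E}(v_n,\alpha_{n+1})$. $\mathsf{Ag}^*$ is the set of finite words over $\mathsf{Ag}$ with no two equal adjacent letters; $\mathsf{Ag}^{\ge n}$ those of length $\ge n$; $aw$ denotes $w$ prefixed by $a$. An information perspective is a set $\mathrm{I}\subseteq\mathsf{Ag}^{\ge2}$; $\mathrm{I}_a=\{b: ab\in\mathrm{I}\}\cup\{a\}$; $\mathrm{I}[a]=\{w\in\mathsf{Ag}^{\ge2}: aw\in\mathrm{I}\}\cup\{w\in\mathrm{I}: w=aw'\text{ for some }w'\in\mathsf{Ag}^*\}$. $\mathrm{I}$ is truthful if for all $a\in\mathsf{Ag}$ and $w\in\mathsf{Ag}^{\ge2}$, $aw\in\mathrm{I}$ implies $w\in\mathrm{I}$. $\chi\sim^{\mathrm{I}}_a\chi'$ iff $\chi(b)=\chi'(b)$ for all $b\in\mathrm{I}_a$. A state is a triple $(\chi,\mathrm{I},\rho)$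 (assignment, information perspective, history); it is $a$-consistent if $\rho$ is consistent with $\chi$ for $\mathrm{I}_a$. $(\chi,\mathrm{I},\rho)\trianglelefteq_a(\chi',\mathrm{I}',\rho')$ iff $\chi\sim^{\mathrm{I}}_a\chi'$, $\mathrm{I}[a]\subseteq\mathrm{I}'$, $\rho\sim_a\rho'$, and both states are $a$-consistent. For $G\subseteq\mathsf{Ag}$, $Z\trianglelefteq_GZ'$ iff $Z\trianglelefteq_aZ'$ for some $a\in G$, and $\trianglelefteq^*_G$ is the transitive closure of $\trianglelefteq_G$. Formulas of $\mathcal{L}^{\mathsf C}$: $\phi::=p\mid\bot\mid\phi\to\phi\mid\mathsf{K}_a\phi\mid\mathsf{C}_G\phi\mid\mathsf{X}\phi$ with $p\in\mathsf{Prop}$, $a\in\mathsf{Ag}$, $G\subseteq\mathsf{Ag}$ ($\lnot\phi$ is $\phi\to\bot$, other connectives as usual). Truth at $Z=(\chi,\mathrm{I},\rho)$: $\mathcal{G},Z\Vdash p$ iff $p\in\ell(\mathsf{last}(\rho))$; $\bot$ is never true; $\to$ is classical; $\mathcal{G},Z\Vdash\mathsf{K}_a\phi$ iff $\mathcal{G},Z'\Vdash\phi$ for all $Z'$ with $Z\trianglelefteq_aZ'$; $\mathcal{G},Z\Vdash\mathsf{C}_G\phi$ iff $\mathcal{G},Z'\Vdash\phi$ for all $Z'$ with $Z\trianglelefteq^*_GZ'$; $\mathcal{G},Z\Vdash\mathsf{X}\phi$ iff $\mathcal{G},(\chi,\mathrm{I},\mathsf{X}^\chi_{\mathcal G}\rho)\Vdash\phi$.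 -}

module Defs where

open import Level using (Level; 0ℓ; Lift; lift) renaming (suc to lsuc)
open import Data.Nat using (ℕ; _≥_)
open import Data.Fin using (Fin)
open import Data.Fin.Subset using (Subset; _∈_)
open import Data.List using (List; []; _∷_; length)
open import Data.Product using (Σ; _×_; _,_; ∃)
open import Data.Sum using (_⊎_)
open import Data.Empty using (⊥)
open import Data.Unit using (⊤)
open import Relation.Nullary using (¬_)
open import Relation.Unary using (Pred)
open import Relation.Binary using (Rel; IsEquivalence)
open import Relation.Binary.PropositionalEquality using (_≡_)
open import Relation.Binary.Construct.Closure.Transitive using (TransClosure)

-- The equivalence ∼_a ⊆ (V×V) ∪ (Ac×Ac) is given as its two
-- components: an equivalence on positions and one on actions.

record CGS (Prop : Set) (nAg : ℕ) : Set₁ where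
  field
    nAc : ℕ
    nV  : ℕ
  Ag : Set
  Ag = Fin nAg
  Ac : Set
  Ac = Fin nAc
  V : Set
  V = Fin nV
  JointAction : Set
  JointAction = Ag → Ac
  field
    E     : V → JointAction → V
    ℓ     : V → Pred Prop 0ℓ
    ∼V    : Ag → Rel V 0ℓ
    ∼Ac   : Ag → Rel Ac 0ℓ
    ∼V-equiv  : ∀ a → IsEquivalence (∼V a)
    ∼Ac-equiv : ∀ a → IsEquivalence (∼Ac a)

NoAdjDup : ∀ {n} → List (Fin n) → Set
NoAdjDup []           = ⊤
NoAdjDup (x ∷ [])     = ⊤
NoAdjDup (x ∷ y ∷ w)  = ¬ (x ≡ y) × NoAdjDup (y ∷ w)

AgGe2 : ∀ {n} → List (Fin n) → Set
AgGe2 w = NoAdjDup w × length w ≥ 2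

record InfoPersp (nAg : ℕ) : Set₁ where
  field
    mem : Pred (List (Fin nAg)) 0ℓ
    wf  : ∀ w → mem w → AgGe2 w
open InfoPersp public

Iₐ : ∀ {n} → InfoPersp n → Fin n → Pred (Fin n) 0ℓ
Iₐ I a b = mem I (a ∷ b ∷ []) ⊎ b ≡ a

I[_] : ∀ {n} → InfoPersp n → Fin n → Pred (List (Fin n)) 0ℓ
I[ I ] a w = (AgGe2 w × mem I (a ∷ w)) ⊎ (mem I w × ∃ λ w' → w ≡ a ∷ w')

Truthful : ∀ {n} → InfoPersp n → Set
Truthful {n} I = ∀ (a : Fin n) (w : List (Fin n)) → AgGe2 w → mem I (a ∷ w) → mem I w

data Formula (Prop : Set) (nAg : ℕ) : Set where
  atom : Prop → Formula Prop nAg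
  ⊥f   : Formula Prop nAg
  _⇒_  : Formula Prop nAg → Formula Prop nAg → Formula Prop nAg
  K    : Fin nAg → Formula Prop nAg → Formula Prop nAg
  C    : Subset nAg → Formula Prop nAg → Formula Prop nAg
  X    : Formula Prop nAg → Formula Prop nAg

infixr 5 _⇒_

¬f : ∀ {Prop n} → Formula Prop n → Formula Prop n
¬f φ = φ ⇒ ⊥f

module Sem {Prop : Set} {nAg : ℕ} (G : CGS Prop nAg) where
  open CGS G

  -- histories v0 α1 v1 … αn vn; since E is a function, each next
  -- position is determined: v_{i+1} = E v_i α_{i+1}
  data Hist : Set where
    init : V → Hist
    _▸_  : Hist → JointAction → Hist

  last : Hist → V
  last (init v) = v
  last (ρ ▸ α)  = E (last ρ) α

  _∼J[_]_ : JointAction → Ag → JointAction → Set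
  α ∼J[ a ] β = ∀ b → ∼Ac a (α b) (β b)

  _∼H[_]_ : Hist → Ag → Hist → Set
  init v  ∼H[ a ] init v'   = ∼V a v v'
  init v  ∼H[ a ] (ρ' ▸ α') = ⊥
  (ρ ▸ α) ∼H[ a ] init v'   = ⊥
  (ρ ▸ α) ∼H[ a ] (ρ' ▸ α') =
    (ρ ∼H[ a ] ρ') × (α ∼J[ a ] α') × ∼V a (last (ρ ▸ α)) (last (ρ' ▸ α'))

  Strategy : Set
  Strategy = Hist → Ac

  Assignment : Set
  Assignment = Ag → Strategy

  Consistent : Assignment → Pred Ag 0ℓ → Hist → Set
  Consistent χ Xs (init v) = ⊤
  Consistent χ Xs (ρ ▸ α)  = Consistent χ Xs ρ × (∀ b → Xs b → α b ≡ χ b ρ)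

  Xstep : Assignment → Hist → Hist
  Xstep χ ρ = ρ ▸ (λ b → χ b ρ)

  record State : Set₁ where
    constructor ⟨_,_,_⟩
    field
      χ : Assignment
      I : InfoPersp nAg
      ρ : Hist
  open State public

  _∼A[_,_]_ : Assignment → InfoPersp nAg → Ag → Assignment → Set
  χ ∼A[ I , a ] χ' = ∀ b → Iₐ I a b → χ b ≡ χ' b

  ConsistentState : Ag → State → Set
  ConsistentState a Z = Consistent (χ Z) (Iₐ (I Z) a) (ρ Z)

  _⊴[_]_ : State → Ag → State → Set
  Z ⊴[ a ] Z' =
    (χ Z ∼A[ I Z , a ] χ Z')
    × (∀ w → I[ I Z ] a w → mem (I Z') w)
    × (ρ Z ∼H[ a ] ρ Z')
    × ConsistentState a Z
    × ConsistentState a Z'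

  _⊴G[_]_ : State → Subset nAg → State → Set
  Z ⊴G[ Gr ] Z' = Σ Ag λ a → a ∈ Gr × Z ⊴[ a ] Z'

  _⊴G*[_]_ : State → Subset nAg → State → Set₁
  Z ⊴G*[ Gr ] Z' = TransClosure (λ Y Y' → Y ⊴G[ Gr ] Y') Z Z'

  _⊩_ : State → Formula Prop nAg → Set₁
  Z ⊩ atom p  = Lift (lsuc 0ℓ) (ℓ (last (ρ Z)) p)
  Z ⊩ ⊥f      = Lift (lsuc 0ℓ) ⊥
  Z ⊩ (φ ⇒ ψ) = Z ⊩ φ → Z ⊩ ψ
  Z ⊩ K a φ   = ∀ Z' → Z ⊴[ a ] Z' → Z' ⊩ φ
  Z ⊩ C Gr φ  = ∀ Z' → Z ⊴G*[ Gr ] Z' → Z' ⊩ φ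
  Z ⊩ X φ     = ⟨ χ Z , I Z , Xstep (χ Z) (ρ Z) ⟩ ⊩ φ

{-# OPTIONS --safe #-}
-- The T axiom K_a φ → φ holds at Z as soon as Z ⊴_a Z. Truthfulness gives
-- I[a] ⊆ I, so ⊴_a is reflexive on a-consistent states. The premise ¬K_a⊥
-- supplies a-consistency: at an a-inconsistent state K_a holds vacuously.
-- Constructively this only yields ¬¬-consistency, which suffices because
-- consistency is built from equalities of actions, and those are decidable.
module Submission where

open import Defs
open import Data.Nat using (ℕ)
open import Data.Fin using (Fin)
open import Data.Fin.Properties using (_≟_)
open import Data.Product using (_,_; proj₁; proj₂)
open import Data.Sum using (inj₁; inj₂)
open import Data.Unit using (tt)
open import Data.Empty using (⊥-elim)
open import Level using (lower)
open import Relation.Nullary using (¬_)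
open import Relation.Nullary.Negation using (Stable; ¬¬-map)
open import Relation.Nullary.Decidable using (decidable-stable)
open import Relation.Binary using (IsEquivalence)
open import Relation.Binary.PropositionalEquality using (refl)

truthful⇒I[]⊆ : ∀ {n} {I : InfoPersp n} → Truthful I → ∀ a w → I[ I ] a w → mem I w
truthful⇒I[]⊆ truthful a w (inj₁ (w∈Ag≥2 , aw∈I)) = truthful a w w∈Ag≥2 aw∈I
truthful⇒I[]⊆ truthful a w (inj₂ (w∈I , _))       = w∈I

module _ {Prop : Set} {nAg : ℕ} (G : CGS Prop nAg) where
  open CGS G
  open Sem G

  Consistent-stable : ∀ ς Xs h → Stable (Consistent ς Xs h)
  Consistent-stable ς Xs (init v) _    = tt
  Consistent-stable ς Xs (h ▸ α)  ¬¬c =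
      Consistent-stable ς Xs h (¬¬-map proj₁ ¬¬c)
    , λ b b∈Xs → decidable-stable (α b ≟ ς b h) (¬¬-map (λ c → proj₂ c b b∈Xs) ¬¬c)

  ∼H-refl : ∀ a h → h ∼H[ a ] h
  ∼H-refl a (init v) = IsEquivalence.refl (∼V-equiv a)
  ∼H-refl a (h ▸ α)  =
    ∼H-refl a h , (λ b → IsEquivalence.refl (∼Ac-equiv a)) , IsEquivalence.refl (∼V-equiv a)

  ⊴-refl : ∀ Z a → Truthful (I Z) → ConsistentState a Z → Z ⊴[ a ] Z
  ⊴-refl Z a truthful cons =
    (λ _ _ → refl) , truthful⇒I[]⊆ {I = I Z} truthful a , ∼H-refl a (ρ Z) , cons , cons

  inconsistent⇒K : ∀ {Z} a φ → ¬ ConsistentState a Z → Z ⊩ K a φ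
  inconsistent⇒K a φ ¬cons _ (_ , _ , _ , cons , _) = ⊥-elim (¬cons cons)

  ¬K⊥⇒consistent : ∀ Z a → Z ⊩ ¬f (K a ⊥f) → ConsistentState a Z
  ¬K⊥⇒consistent Z a ¬K⊥ =
    Consistent-stable (χ Z) (Iₐ (I Z) a) (ρ Z)
      (λ ¬cons → lower (¬K⊥ (inconsistent⇒K {Z} a ⊥f ¬cons)))

lemma4 : {Prop : Set} {nAg : ℕ} (G : CGS Prop nAg)
    → (χ : Sem.Assignment G) (I : InfoPersp nAg) (ρ : Sem.Hist G)
    → Truthful I
    → (a : Fin nAg) (φ : Formula Prop nAg)
    → Sem._⊩_ G (Sem.⟨_,_,_⟩ χ I ρ) (¬f (K a ⊥f) ⇒ (K a φ ⇒ φ))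
lemma4 G χ I ρ truthful a φ ¬K⊥ Kφ =
  Kφ Z (⊴-refl G Z a truthful (¬K⊥⇒consistent G Z a ¬K⊥))
  where
  Z : Sem.State G
  Z = Sem.⟨_,_,_⟩ χ I ρ
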